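{- For all $n\ge1$, $$\operatorname{tr}M^{(W(n))}(x)=\sum_{k=1}^{n+1}x^k\,k!\left(S(n+2,k+1)-S(n+1,k+1)\right),$$ where $S(\cdot,\cdot)$ denotes Stirling numbers of the second kind.
   Context: A 4-tuple $(x,y,a,b)$ is an edge from peg $x$ at height $a$ to peg $y$ at height $b$ (height 1 = bottom). $W(n)$ is the set (a web world) of web diagrams on $n+2$ pegs $D=\{(i,i+1,x_i,y_{i+1}):1\le i\le n+1\}$ with $x_1=y_{n+2}=1$ and $\{x_i,y_i\}=\{1,2\}$ for $2\le i\le n+1$. Reconstruction: $D\oplus D'=D\cup\{(x',y',a'+p_{x'}(D),b'+p_{y'}(D)):(x',y',a',b')\in D'\}$, $p_i(D)$ the number of endpoints of $D$ on peg $i$; $\mathrm{rel}(X)$ relabels heights of endpoints of edges of $X$ on each peg by $1,\dots,\ell_i$ preserving relative order; an $\ell$-colouring of $D$ is a surjection $c$ from its edges onto $\{1,\dots,\ell\}$, and $\mathcal{R}(D,c)=\mathrm{rel}(D_c(1))\oplus\cdots\oplus\mathrm{rel}(D_c(\ell))$ with $D_c(t)$ the edges of colour $t$. $f(D_1,D_2,\ell)$ is the number of $\ell$-colourings $c$ of $D_1$ with $\mathcal{R}(D_1,c)=D_2$; the web-colouring matrix has entries $M^{(W)}_{D_1,D_2}(x)=\sum_{\ell\ge1}x^\ell f(D_1,D_2,\ell)$. -}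

module Defs where

open import Data.Nat using (ℕ; zero; suc; _+_; _*_; _!; _≡ᵇ_; _<ᵇ_; _≤ᵇ_)
open import Data.Bool using (Bool; true; false; _∧_; if_then_else_)
open import Data.Product using (_×_; _,_; proj₁; proj₂)
open import Data.List using (List; []; _∷_; _++_; map; foldl; length; zip; concatMap; allFin)
open import Data.Nat.ListAction using (sum)
open import Data.Fin using (Fin; toℕ)
open import Data.Vec using (Vec; []; _∷_; toList)
open import Data.Integer using (ℤ; +_; _-_) renaming (_*_ to _*ℤ_)

-- Edges and diagrams
-- An edge (x , y , a , b) goes from peg x at height a to peg y at height b.
Edge : Set
Edge = ℕ × ℕ × ℕ × ℕ

-- A diagram is a finite set of edges, represented by a list (without
-- duplicates for web diagrams); equality of diagrams is set equality.
Diagram : Set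
Diagram = List Edge

boolFilter : {A : Set} → (A → Bool) → List A → List A
boolFilter p [] = []
boolFilter p (x ∷ xs) = if p x then x ∷ boolFilter p xs else boolFilter p xs

all : {A : Set} → (A → Bool) → List A → Bool
all p [] = true
all p (x ∷ xs) = p x ∧ all p xs

any : {A : Set} → (A → Bool) → List A → Bool
any p [] = false
any p (x ∷ xs) = if p x then true else any p xs

edgeEqᵇ : Edge → Edge → Bool
edgeEqᵇ (x , y , a , b) (x' , y' , a' , b') =
  (x ≡ᵇ x') ∧ (y ≡ᵇ y') ∧ (a ≡ᵇ a') ∧ (b ≡ᵇ b')

memᵇ : Edge → Diagram → Bool
memᵇ e D = any (edgeEqᵇ e) D

sameDiagramᵇ : Diagram → Diagram → Bool
sameDiagramᵇ D D' = all (λ e → memᵇ e D') D ∧ all (λ e → memᵇ e D) D'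

[_==_] : ℕ → ℕ → ℕ
[ i == j ] = if i ≡ᵇ j then 1 else 0

pegCount : ℕ → Diagram → ℕ
pegCount i D = sum (map (λ { (x , y , a , b) → [ x == i ] + [ y == i ] }) D)

_⊕_ : Diagram → Diagram → Diagram
D ⊕ D' = D ++ map (λ { (x , y , a , b) → (x , y , a + pegCount x D , b + pegCount y D) }) D'

heightsOn : ℕ → Diagram → List ℕ
heightsOn i X = concatMap (λ { (x , y , a , b) →
  (if x ≡ᵇ i then a ∷ [] else []) ++ (if y ≡ᵇ i then b ∷ [] else []) }) X

-- new height of an endpoint of height h on peg i: its rank among the
-- endpoint heights on peg i (heights 1,…,ℓ_i, order preserved)
rank : ℕ → ℕ → Diagram → ℕ
rank i h X = length (boolFilter (λ h' → h' ≤ᵇ h) (heightsOn i X))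

rel : Diagram → Diagram
rel X = map (λ { (x , y , a , b) → (x , y , rank x a X , rank y b X) }) X

-- Colourings.  An ℓ-colouring of D (a list of m edges) is a vector
-- c : Vec (Fin ℓ) m assigning colour (toℕ (c_j) + 1) to the j-th edge,
-- which must be surjective onto the ℓ colours.

allVecs : (ℓ m : ℕ) → List (Vec (Fin ℓ) m)
allVecs ℓ zero = [] ∷ []
allVecs ℓ (suc m) = concatMap (λ t → map (t ∷_) (allVecs ℓ m)) (allFin ℓ)

finEqᵇ : {ℓ : ℕ} → Fin ℓ → Fin ℓ → Bool
finEqᵇ s t = toℕ s ≡ᵇ toℕ t

surjectiveᵇ : {ℓ m : ℕ} → Vec (Fin ℓ) m → Bool
surjectiveᵇ {ℓ} c = all (λ t → any (finEqᵇ t) (toList c)) (allFin ℓ)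

colourClass : {ℓ : ℕ} → (D : Diagram) → Vec (Fin ℓ) (length D) → Fin ℓ → Diagram
colourClass D c t = map proj₁ (boolFilter (λ p → finEqᵇ (proj₂ p) t) (zip D (toList c)))

-- R(D,c) = rel(D_c(1)) ⊕ ⋯ ⊕ rel(D_c(ℓ))   (⊕ is associative; [] is a unit)
reconstruct : {ℓ : ℕ} → (D : Diagram) → Vec (Fin ℓ) (length D) → Diagram
reconstruct {ℓ} D c = foldl _⊕_ [] (map (λ t → rel (colourClass D c t)) (allFin ℓ))

f : Diagram → Diagram → ℕ → ℕ
f D₁ D₂ ℓ = length (boolFilter
  (λ c → surjectiveᵇ c ∧ sameDiagramᵇ (reconstruct D₁ c) D₂)
  (allVecs ℓ (length D₁)))

-- coefficient of x^ℓ in the entry M^(W)_{D1,D2}(x) = Σ_{ℓ≥1} x^ℓ f(D1,D2,ℓ)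
webColouringCoeff : Diagram → Diagram → ℕ → ℕ
webColouringCoeff D₁ D₂ zero = 0
webColouringCoeff D₁ D₂ (suc ℓ) = f D₁ D₂ (suc ℓ)

-- The web world W(n).
-- A choice vector v : Vec Bool n gives x_i for 2 ≤ i ≤ n+1
-- (false ↦ 1, true ↦ 2), with y_i the other element of {1,2};
-- x_1 = 1 and y_{n+2} = 1.

bit : Bool → ℕ
bit false = 1
bit true = 2

other : Bool → ℕ
other false = 2
other true = 1

-- edges (i, i+1, x_i, y_{i+1}) for i = k, k+1, …, given x_k and the
-- choices for pegs k+1, …
webEdges : {n : ℕ} → ℕ → ℕ → Vec Bool n → Diagram
webEdges i xi [] = (i , suc i , xi , 1) ∷ []
webEdges i xi (b ∷ v) = (i , suc i , xi , other b) ∷ webEdges (suc i) (bit b) v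

webDiagram : {n : ℕ} → Vec Bool n → Diagram
webDiagram v = webEdges 1 1 v

allBoolVecs : (n : ℕ) → List (Vec Bool n)
allBoolVecs zero = [] ∷ []
allBoolVecs (suc n) = concatMap (λ b → map (b ∷_) (allBoolVecs n)) (true ∷ false ∷ [])

-- W(n), as a list of its (pairwise distinct) diagrams
W : ℕ → List Diagram
W n = map webDiagram (allBoolVecs n)

-- coefficient of x^ℓ in tr M^(W(n))(x)
traceCoeff : ℕ → ℕ → ℕ
traceCoeff n ℓ = sum (map (λ D → webColouringCoeff D D ℓ) (W n))

S : ℕ → ℕ → ℕ
S zero zero = 1
S zero (suc k) = 0
S (suc n) zero = 0
S (suc n) (suc k) = suc k * S n (suc k) + S n k

-- coefficient of x^k in Σ_{k=1}^{n+1} x^k k! (S(n+2,k+1) - S(n+1,k+1))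
rhsCoeff : ℕ → ℕ → ℤ
rhsCoeff n k = if (1 ≤ᵇ k) ∧ (k ≤ᵇ suc n)
  then + (k !) *ℤ (+ S (suc (suc n)) (suc k) - + S (suc n) (suc k))
  else + 0

module Submission where

-- A web diagram of W(n) is a path of n+1 edges whose shape is a vector v
-- of n choices, one per inner peg.  The argument has three parts.
--
-- 1. Reconstruction.  R(D,c) stacks the colour classes of c; an edge lands
--    at its rank within its class, shifted up by the endpoints of smaller
--    colour on its peg (all-layers).  Along a path only neighbouring edges
--    share a peg, so R(D,c) = D exactly when, at every inner peg, the
--    colours of the two edges are ordered as the choice there prescribes
--    (reconstruct-web).
-- 2. Counting.  Summing over v, each step of a colour word contributes
--    1 + [equal colours]; the resulting count of pairs (v, surjective
--    compatible c) with ℓ colours follows the r-Stirling recursion and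
--    equals ℓ! · rStirling n 2 (ℓ − 1) (compatibleSurjections≡).
-- 3. Stirling numbers.  rStirling n 2 k = S(n+2,k+2) − S(n+1,k+2)
--    (stirling-split), and it vanishes for k > n (rStirling-vanish).
-- The theorem compares the coefficients of x^k.

open import Defs
open import Data.Nat
open import Data.Nat.Properties
open import Data.Bool using (Bool; true; false; _∧_; _∨_; not; if_then_else_; T)
open import Data.Bool.Properties using (∧-assoc; ∧-identityʳ; ∧-zeroʳ; ∧-idem; ∨-identityʳ; ∨-zeroʳ; not-involutive)
open import Data.Unit using (tt)
open import Data.Empty using (⊥; ⊥-elim)
open import Data.List using (List; []; _∷_; _++_; map; concatMap; length; allFin; zip; foldl)
open import Data.List.Properties using (map-cong; map-∘; length-map; map-tabulate; length-tabulate)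
open import Data.Nat.ListAction using (sum)
open import Data.Vec using (Vec; []; _∷_; toList)
open import Data.Vec.Properties using (length-toList)
open import Data.Fin using (Fin; toℕ) renaming (zero to fzero; suc to fsuc)
open import Data.Fin.Properties using (toℕ<n)
open import Data.Product using (_×_; _,_; proj₁; proj₂)
open import Data.Sum using (_⊎_; inj₁; inj₂)
open import Relation.Binary.PropositionalEquality
open import Relation.Nullary using (yes; no)
open import Function using (_∘_)
open import Data.Nat.Tactic.RingSolver using (solve-∀)

open ≡-Reasoning

ind : Bool → ℕ
ind true = 1
ind false = 0

∑ : {A : Set} → List A → (A → ℕ) → ℕ
∑ xs f = sum (map f xs)

∑-cong : {A : Set} (xs : List A) {f h : A → ℕ} → (∀ x → f x ≡ h x) → ∑ xs f ≡ ∑ xs h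
∑-cong [] e = refl
∑-cong (x ∷ xs) e = cong₂ _+_ (e x) (∑-cong xs e)

∑-+ : {A : Set} (xs : List A) (f h : A → ℕ) → ∑ xs (λ x → f x + h x) ≡ ∑ xs f + ∑ xs h
∑-+ [] f h = refl
∑-+ (x ∷ xs) f h rewrite ∑-+ xs f h = interchange (f x) (h x) (∑ xs f) (∑ xs h)
  where
  interchange : ∀ a b c d → a + b + (c + d) ≡ a + c + (b + d)
  interchange = solve-∀

∑-*ˡ : {A : Set} (xs : List A) (k : ℕ) (f : A → ℕ) → ∑ xs (λ x → k * f x) ≡ k * ∑ xs f
∑-*ˡ [] k f = sym (*-zeroʳ k)
∑-*ˡ (x ∷ xs) k f rewrite ∑-*ˡ xs k f = sym (*-distribˡ-+ k (f x) (∑ xs f))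

∑-*ʳ : {A : Set} (xs : List A) (k : ℕ) (f : A → ℕ) → ∑ xs (λ x → f x * k) ≡ ∑ xs f * k
∑-*ʳ xs k f = trans (∑-cong xs (λ x → *-comm (f x) k)) (trans (∑-*ˡ xs k f) (*-comm k _))

∑-map : {A B : Set} (xs : List A) (h : A → B) (f : B → ℕ) → ∑ (map h xs) f ≡ ∑ xs (f ∘ h)
∑-map [] h f = refl
∑-map (x ∷ xs) h f = cong (f (h x) +_) (∑-map xs h f)

∑-++ : {A : Set} (xs ys : List A) (f : A → ℕ) → ∑ (xs ++ ys) f ≡ ∑ xs f + ∑ ys f
∑-++ [] ys f = refl
∑-++ (x ∷ xs) ys f = trans (cong (f x +_) (∑-++ xs ys f)) (sym (+-assoc (f x) _ _))

∑-concatMap : {A B : Set} (xs : List A) (h : A → List B) (f : B → ℕ) →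
  ∑ (concatMap h xs) f ≡ ∑ xs (λ x → ∑ (h x) f)
∑-concatMap [] h f = refl
∑-concatMap (x ∷ xs) h f = trans (∑-++ (h x) (concatMap h xs) f) (cong (∑ (h x) f +_) (∑-concatMap xs h f))

∑-const : {A : Set} (xs : List A) (k : ℕ) → ∑ xs (λ _ → k) ≡ length xs * k
∑-const [] k = refl
∑-const (x ∷ xs) k = cong (k +_) (∑-const xs k)

∑-zero : {A : Set} (xs : List A) {f : A → ℕ} → (∀ x → f x ≡ 0) → ∑ xs f ≡ 0
∑-zero xs e = trans (∑-cong xs e) (trans (∑-const xs 0) (*-zeroʳ (length xs)))

∑-swap : {A B : Set} (xs : List A) (ys : List B) (f : A → B → ℕ) →
  ∑ xs (λ x → ∑ ys (λ y → f x y)) ≡ ∑ ys (λ y → ∑ xs (λ x → f x y))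
∑-swap [] ys f = sym (∑-zero ys (λ _ → refl))
∑-swap (x ∷ xs) ys f rewrite ∑-swap xs ys f = sym (∑-+ ys (f x) (λ y → ∑ xs (λ x' → f x' y)))

length-filter : {A : Set} (p : A → Bool) (xs : List A) → length (boolFilter p xs) ≡ ∑ xs (ind ∘ p)
length-filter p [] = refl
length-filter p (x ∷ xs) with p x
... | true = cong suc (length-filter p xs)
... | false = length-filter p xs

filter-cong : {A : Set} {p q : A → Bool} (xs : List A) → (∀ x → p x ≡ q x) → boolFilter p xs ≡ boolFilter q xs
filter-cong [] e = refl
filter-cong {q = q} (x ∷ xs) e rewrite e x with q x
... | true = cong (x ∷_) (filter-cong xs e)
... | false = filter-cong xs e

all-cong : {A : Set} {p q : A → Bool} (xs : List A) → (∀ x → p x ≡ q x) → all p xs ≡ all q xs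
all-cong [] e = refl
all-cong (x ∷ xs) e = cong₂ _∧_ (e x) (all-cong xs e)

all-map : {A B : Set} (p : B → Bool) (h : A → B) (xs : List A) → all p (map h xs) ≡ all (p ∘ h) xs
all-map p h [] = refl
all-map p h (x ∷ xs) = cong (p (h x) ∧_) (all-map p h xs)

all-++ : {A : Set} (p : A → Bool) (xs ys : List A) → all p (xs ++ ys) ≡ all p xs ∧ all p ys
all-++ p [] ys = refl
all-++ p (x ∷ xs) ys = trans (cong (p x ∧_) (all-++ p xs ys)) (sym (∧-assoc (p x) _ _))

all-true : {A : Set} (xs : List A) → all (λ _ → true) xs ≡ true
all-true [] = refl
all-true (x ∷ xs) = all-true xs

all-∧ : {A : Set} (p q : A → Bool) (xs : List A) → all (λ x → p x ∧ q x) xs ≡ all p xs ∧ all q xs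
all-∧ p q [] = refl
all-∧ p q (x ∷ xs) rewrite all-∧ p q xs with p x | q x
... | true | true = refl
... | true | false = sym (∧-zeroʳ (all p xs))
... | false | _ = refl

all-swap : {A B : Set} (xs : List A) (ys : List B) (p : A → B → Bool) →
  all (λ x → all (p x) ys) xs ≡ all (λ y → all (λ x → p x y) xs) ys
all-swap [] ys p = sym (all-true ys)
all-swap (x ∷ xs) ys p = trans (cong (all (p x) ys ∧_) (all-swap xs ys p)) (sym (all-∧ (p x) _ ys))

any-all : {A : Set} (p : A → Bool) (xs : List A) → any p xs ≡ not (all (not ∘ p) xs)
any-all p [] = refl
any-all p (x ∷ xs) with p x
... | true = refl
... | false = any-all p xs

≡ᵇ-refl : ∀ x → (x ≡ᵇ x) ≡ true
≡ᵇ-refl zero = refl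
≡ᵇ-refl (suc x) = ≡ᵇ-refl x

≡ᵇ-true⇒≡ : ∀ x y → (x ≡ᵇ y) ≡ true → x ≡ y
≡ᵇ-true⇒≡ x y e = ≡ᵇ⇒≡ x y (subst T (sym e) tt)

<ᵇ-irrefl : ∀ x → (x <ᵇ x) ≡ false
<ᵇ-irrefl zero = refl
<ᵇ-irrefl (suc x) = <ᵇ-irrefl x

<ᵇ-suc : ∀ m n → (m <ᵇ suc n) ≡ (m ≤ᵇ n)
<ᵇ-suc zero n = refl
<ᵇ-suc (suc m) n = refl

≤ᵇ-true : ∀ m n → m ≤ n → (m ≤ᵇ n) ≡ true
≤ᵇ-true zero n _ = refl
≤ᵇ-true (suc m) (suc n) (s≤s m≤n) = trans (<ᵇ-suc m n) (≤ᵇ-true m n m≤n)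

≤ᵇ-false : ∀ m n → n < m → (m ≤ᵇ n) ≡ false
≤ᵇ-false (suc m) zero _ = refl
≤ᵇ-false (suc m) (suc n) (s≤s n<m) = trans (<ᵇ-suc m n) (≤ᵇ-false m n n<m)

≤ᵇ-refl : ∀ x → (x ≤ᵇ x) ≡ true
≤ᵇ-refl x = ≤ᵇ-true x x ≤-refl

<⇒≢ᵇ : ∀ m n → m < n → (m ≡ᵇ n) ≡ false
<⇒≢ᵇ zero (suc n) _ = refl
<⇒≢ᵇ (suc m) (suc n) (s≤s m<n) = <⇒≢ᵇ m n m<n

>⇒≢ᵇ : ∀ m n → n < m → (m ≡ᵇ n) ≡ false
>⇒≢ᵇ (suc m) zero _ = refl
>⇒≢ᵇ (suc m) (suc n) (s≤s n<m) = >⇒≢ᵇ m n n<m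

≡ᵇ-cancelˡ : ∀ i x y → (i + x ≡ᵇ i + y) ≡ (x ≡ᵇ y)
≡ᵇ-cancelˡ zero x y = refl
≡ᵇ-cancelˡ (suc i) x y = ≡ᵇ-cancelˡ i x y

allFin-suc : ∀ ℓ → allFin (suc ℓ) ≡ fzero ∷ map fsuc (allFin ℓ)
allFin-suc ℓ = cong (fzero ∷_) (sym (map-tabulate (λ x → x) fsuc))

∑-allFin-suc : ∀ ℓ (f : Fin (suc ℓ) → ℕ) → ∑ (allFin (suc ℓ)) f ≡ f fzero + ∑ (allFin ℓ) (f ∘ fsuc)
∑-allFin-suc ℓ f = trans (cong (λ L → ∑ L f) (allFin-suc ℓ)) (cong (f fzero +_) (∑-map (allFin ℓ) fsuc f))

all-allFin-suc : ∀ ℓ (p : Fin (suc ℓ) → Bool) → all p (allFin (suc ℓ)) ≡ p fzero ∧ all (p ∘ fsuc) (allFin ℓ)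
all-allFin-suc ℓ p = trans (cong (all p) (allFin-suc ℓ)) (cong (p fzero ∧_) (all-map p fsuc (allFin ℓ)))

length-allFin : ∀ ℓ → length (allFin ℓ) ≡ ℓ
length-allFin ℓ = length-tabulate (λ x → x)

ind-<ᵇ-suc : ∀ x a → ind (x <ᵇ suc a) ≡ ind (x <ᵇ a) + ind (x ≡ᵇ a)
ind-<ᵇ-suc zero zero = refl
ind-<ᵇ-suc zero (suc a) = refl
ind-<ᵇ-suc (suc x) zero = refl
ind-<ᵇ-suc (suc x) (suc a) = ind-<ᵇ-suc x a

range : ℕ → ℕ → List ℕ
range a zero = []
range a (suc r) = a ∷ range (suc a) r

range-suc : ∀ a r → range (suc a) r ≡ map suc (range a r)
range-suc a zero = refl
range-suc a (suc r) = cong (suc a ∷_) (range-suc (suc a) r)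

length-range : ∀ a r → length (range a r) ≡ r
length-range a zero = refl
length-range a (suc r) = cong suc (length-range (suc a) r)

toℕ-allFin : ∀ ℓ → map toℕ (allFin ℓ) ≡ range 0 ℓ
toℕ-allFin zero = refl
toℕ-allFin (suc ℓ) = trans (cong (map toℕ) (allFin-suc ℓ))
  (cong (0 ∷_) (trans (sym (map-∘ (allFin ℓ))) (trans (map-∘ {g = suc} {f = toℕ} (allFin ℓ))
    (trans (cong (map suc) (toℕ-allFin ℓ)) (sym (range-suc 0 ℓ))))))

range-empty : ∀ {a k} → a ≤ k → k < a + 0 → ⊥
range-empty {a} {k} a≤k k< = <-irrefl refl (≤-trans k< (subst (_≤ k) (sym (+-identityʳ a)) a≤k))

all-cong-range : ∀ a r (p q : ℕ → Bool) → (∀ k → a ≤ k → k < a + r → p k ≡ q k) → all p (range a r) ≡ all q (range a r)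
all-cong-range a zero p q h = refl
all-cong-range a (suc r) p q h =
  cong₂ _∧_ (h a ≤-refl (subst (a <_) (sym (+-suc a r)) (s≤s (m≤m+n a r))))
    (all-cong-range (suc a) r p q (λ k a<k k< → h k (<⇒≤ a<k) (subst (k <_) (sym (+-suc a r)) k<)))

∧-true-left : ∀ a b → (a ∧ b) ≡ true → a ≡ true
∧-true-left true b _ = refl

∧-true-right : ∀ a b → (a ∧ b) ≡ true → b ≡ true
∧-true-right true b h = h

all-range-elim : ∀ a r (p : ℕ → Bool) → all p (range a r) ≡ true → ∀ k → a ≤ k → k < a + r → p k ≡ true
all-range-elim a zero p h k a≤k k< = ⊥-elim (range-empty a≤k k<)
all-range-elim a (suc r) p h k a≤k k< with m≤n⇒m<n∨m≡n a≤k
... | inj₂ refl = ∧-true-left (p a) _ h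
... | inj₁ a<k = all-range-elim (suc a) r p (∧-true-right (p a) _ h) k a<k (subst (k <_) (+-suc a r) k<)

all-range-miss : ∀ c a r (G : ℕ → Bool) → c < a → all (λ s → not (c ≡ᵇ s) ∨ G s) (range a r) ≡ true
all-range-miss c a zero G _ = refl
all-range-miss c a (suc r) G c<a rewrite <⇒≢ᵇ c a c<a = all-range-miss c (suc a) r G (m<n⇒m<1+n c<a)

all-range-select : ∀ c a r (G : ℕ → Bool) → a ≤ c → c < a + r → all (λ s → not (c ≡ᵇ s) ∨ G s) (range a r) ≡ G c
all-range-select c a zero G a≤c c< = ⊥-elim (range-empty a≤c c<)
all-range-select c a (suc r) G a≤c c< with m≤n⇒m<n∨m≡n a≤c
... | inj₂ refl rewrite ≡ᵇ-refl a | all-range-miss a (suc a) r G ≤-refl = ∧-identityʳ (G a)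
... | inj₁ a<c rewrite >⇒≢ᵇ c a a<c = all-range-select c (suc a) r G a<c (subst (c <_) (+-suc a r) c<)

∑-range-miss : ∀ a r j (f : ℕ → ℕ) → j < a ⊎ a + r ≤ j → ∑ (range a r) (λ k → ind (k ≡ᵇ j) * f k) ≡ 0
∑-range-miss a zero j f _ = refl
∑-range-miss a (suc r) j f (inj₁ j<a) rewrite >⇒≢ᵇ a j j<a = ∑-range-miss (suc a) r j f (inj₁ (m<n⇒m<1+n j<a))
∑-range-miss a (suc r) j f (inj₂ a+r≤j) rewrite <⇒≢ᵇ a j (≤-trans (s≤s (m≤m+n a r)) (subst (_≤ j) (+-suc a r) a+r≤j)) =
  ∑-range-miss (suc a) r j f (inj₂ (subst (_≤ j) (+-suc a r) a+r≤j))

∑-range-select : ∀ a r j (f : ℕ → ℕ) → a ≤ j → j < a + r → ∑ (range a r) (λ k → ind (k ≡ᵇ j) * f k) ≡ f j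
∑-range-select a zero j f a≤j j< = ⊥-elim (range-empty a≤j j<)
∑-range-select a (suc r) j f a≤j j< with m≤n⇒m<n∨m≡n a≤j
... | inj₂ refl rewrite ≡ᵇ-refl a | ∑-range-miss (suc a) r a f (inj₁ ≤-refl) = trans (+-identityʳ _) (+-identityʳ _)
... | inj₁ a<j rewrite <⇒≢ᵇ a j a<j = ∑-range-select (suc a) r j f a<j (subst (j <_) (+-suc a r) j<)

-- rStirling n a k is the number of partitions of a set of n + a elements,
-- a of them distinguished, into k + a blocks such that distinguished
-- elements lie in distinct blocks (the r-Stirling number with r = a).
-- An undistinguished element either joins a distinguished block, or
-- becomes distinguished itself.
rStirling : ℕ → ℕ → ℕ → ℕ
rStirling n a zero = a ^ n
rStirling zero a (suc k) = 0
rStirling (suc n) a (suc k) = a * rStirling n a (suc k) + rStirling n (suc a) k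

-- The usual Stirling recurrence, obtained by removing the last element.
rStirling-suc : ∀ n a k →
  rStirling (suc n) a (suc k) ≡ suc (a + k) * rStirling n a (suc k) + rStirling n a k
rStirling-suc zero a zero rewrite *-zeroʳ a | *-zeroʳ (suc (a + 0)) = refl
rStirling-suc zero a (suc k) rewrite *-zeroʳ a | *-zeroʳ (suc (a + suc k)) = refl
rStirling-suc (suc n) a zero = begin
    a * rStirling (suc n) a 1 + suc a * rStirling n (suc a) 0
  ≡⟨ cong (λ t → a * t + suc a * rStirling n (suc a) 0) (rStirling-suc n a zero) ⟩
    a * (suc (a + 0) * rStirling n a 1 + a ^ n) + suc a * rStirling n (suc a) 0
  ≡⟨ regroup a (rStirling n a 1) (a ^ n) (rStirling n (suc a) 0) ⟩
    suc (a + 0) * (a * rStirling n a 1 + rStirling n (suc a) 0) + a * a ^ n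
  ∎
  where
  regroup : ∀ a x y z → a * (suc (a + 0) * x + y) + suc a * z ≡ suc (a + 0) * (a * x + z) + a * y
  regroup = solve-∀
rStirling-suc (suc n) a (suc k) = begin
    a * rStirling (suc n) a (suc (suc k)) + rStirling (suc n) (suc a) (suc k)
  ≡⟨ cong₂ (λ t u → a * t + u) (rStirling-suc n a (suc k)) (rStirling-suc n (suc a) k) ⟩
    a * (suc (a + suc k) * x + y) + (suc (suc a + k) * z + w)
  ≡⟨ regroup a k x y z w ⟩
    suc (a + suc k) * (a * x + z) + (a * y + w)
  ∎
  where
  x y z w : ℕ
  x = rStirling n a (suc (suc k))
  y = rStirling n a (suc k)
  z = rStirling n (suc a) (suc k)
  w = rStirling n (suc a) k
  regroup : ∀ a k x y z w → a * (suc (a + suc k) * x + y) + (suc (suc a + k) * z + w)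
                          ≡ suc (a + suc k) * (a * x + z) + (a * y + w)
  regroup = solve-∀

-- There are no partitions with more undistinguished blocks than elements.
rStirling-vanish : ∀ n a k → n < k → rStirling n a k ≡ 0
rStirling-vanish zero a (suc k) _ = refl
rStirling-vanish (suc n) a (suc k) (s≤s n<k)
  rewrite rStirling-vanish n a (suc k) (m<n⇒m<1+n n<k) | rStirling-vanish n (suc a) k n<k | *-zeroʳ a = refl

S-one : ∀ m → S (suc m) 1 ≡ 1
S-one zero = refl
S-one (suc m) rewrite S-one m = refl

-- Partitions of n+2 elements into k+2 blocks either separate the last two
-- elements (counted by rStirling n 2 k) or not (these are the partitions
-- of n+1 elements into k+2 blocks).
stirling-split : ∀ n k → S (suc (suc n)) (suc (suc k)) ≡ rStirling n 2 k + S (suc n) (suc (suc k))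
stirling-split zero zero = refl
stirling-split zero (suc k) rewrite *-zeroʳ (suc k) | *-zeroʳ k = refl
stirling-split (suc n) zero = begin
    2 * S (suc (suc n)) 2 + S (suc (suc n)) 1
  ≡⟨ cong₂ (λ x y → 2 * x + y) (stirling-split n zero) (S-one (suc n)) ⟩
    2 * (2 ^ n + S (suc n) 2) + 1
  ≡⟨ regroup (2 ^ n) (S (suc n) 2) ⟩
    2 * 2 ^ n + (2 * S (suc n) 2 + 1)
  ≡⟨ cong (λ w → 2 * 2 ^ n + (2 * S (suc n) 2 + w)) (sym (S-one n)) ⟩
    2 * 2 ^ n + S (suc (suc n)) 2
  ∎
  where
  regroup : ∀ x y → 2 * (x + y) + 1 ≡ 2 * x + (2 * y + 1)
  regroup = solve-∀
stirling-split (suc n) (suc k) = begin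
    (3 + k) * S (suc (suc n)) (3 + k) + S (suc (suc n)) (2 + k)
  ≡⟨ cong₂ (λ x y → (3 + k) * x + y) (stirling-split n (suc k)) (stirling-split n k) ⟩
    (3 + k) * (rStirling n 2 (suc k) + S (suc n) (3 + k)) + (rStirling n 2 k + S (suc n) (2 + k))
  ≡⟨ regroup (3 + k) (rStirling n 2 (suc k)) (S (suc n) (3 + k)) (rStirling n 2 k) (S (suc n) (2 + k)) ⟩
    ((3 + k) * rStirling n 2 (suc k) + rStirling n 2 k) + S (suc (suc n)) (3 + k)
  ≡⟨ cong (_+ S (suc (suc n)) (3 + k)) (sym (rStirling-suc n 2 k)) ⟩
    rStirling (suc n) 2 (suc k) + S (suc (suc n)) (3 + k)
  ∎
  where
  regroup : ∀ c x y z w → c * (x + y) + (z + w) ≡ (c * x + z) + (c * y + w)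
  regroup = solve-∀

colours : ∀ {ℓ m} → Vec (Fin ℓ) m → List ℕ
colours c = map toℕ (toList c)

-- ordered b x y: the relation that consecutive colours x, y must satisfy
-- for the step b of a web diagram (b = true: x ≤ y, b = false: y ≤ x).
ordered : Bool → ℕ → ℕ → Bool
ordered true x y = x ≤ᵇ y
ordered false x y = y ≤ᵇ x

compatible : ∀ {n} → Vec Bool n → List ℕ → Bool
compatible [] cs = true
compatible (b ∷ v) (x ∷ y ∷ cs) = ordered b x y ∧ compatible v (y ∷ cs)
compatible (b ∷ v) _ = false

ordered-both : ∀ x y → ind (ordered true x y) + ind (ordered false x y) ≡ suc (ind (x ≡ᵇ y))
ordered-both zero zero = refl
ordered-both zero (suc y) = refl
ordered-both (suc x) zero = refl
ordered-both (suc x) (suc y) rewrite <ᵇ-suc x y | <ᵇ-suc y x = ordered-both x y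

ColourSet : ℕ → Set
ColourSet ℓ = Fin ℓ → Bool

∅ : ∀ {ℓ} → ColourSet ℓ
∅ _ = false

insert : ∀ {ℓ} → ColourSet ℓ → Fin ℓ → ColourSet ℓ
insert U a t = U t ∨ finEqᵇ t a

card : ∀ {ℓ} → ColourSet ℓ → ℕ
card {ℓ} V = ∑ (allFin ℓ) (ind ∘ V)

covers : ∀ {ℓ} → ColourSet ℓ → List (Fin ℓ) → Bool
covers {ℓ} U cs = all (λ t → U t ∨ any (finEqᵇ t) cs) (allFin ℓ)

covers-∷ : ∀ {ℓ} (U : ColourSet ℓ) a cs → covers U (a ∷ cs) ≡ covers (insert U a) cs
covers-∷ {ℓ} U a cs = all-cong (allFin ℓ) reassociate
  where
  reassociate : ∀ t → (U t ∨ any (finEqᵇ t) (a ∷ cs)) ≡ ((U t ∨ finEqᵇ t a) ∨ any (finEqᵇ t) cs)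
  reassociate t with U t | finEqᵇ t a
  ... | true | _ = refl
  ... | false | true = refl
  ... | false | false = refl

card-insert : ∀ {ℓ} (V : ColourSet ℓ) a → card (insert V a) ≡ card V + ind (not (V a))
card-insert {suc ℓ} V fzero = begin
    card (insert V fzero)
  ≡⟨ ∑-allFin-suc ℓ _ ⟩
    ind (V fzero ∨ true) + card {ℓ} (λ t → V (fsuc t) ∨ false)
  ≡⟨ cong₂ _+_ (cong ind (∨-zeroʳ (V fzero))) (∑-cong (allFin ℓ) (λ t → cong ind (∨-identityʳ (V (fsuc t))))) ⟩
    1 + card (V ∘ fsuc)
  ≡⟨ count (V fzero) (card (V ∘ fsuc)) ⟩
    ind (V fzero) + card (V ∘ fsuc) + ind (not (V fzero))
  ≡⟨ cong (_+ ind (not (V fzero))) (sym (∑-allFin-suc ℓ (ind ∘ V))) ⟩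
    card V + ind (not (V fzero))
  ∎
  where
  count : ∀ b x → 1 + x ≡ ind b + x + ind (not b)
  count true x = sym (+-identityʳ _)
  count false x = +-comm 1 x
card-insert {suc ℓ} V (fsuc a) = begin
    card (insert V (fsuc a))
  ≡⟨ ∑-allFin-suc ℓ _ ⟩
    ind (V fzero ∨ false) + card (insert (V ∘ fsuc) a)
  ≡⟨ cong₂ _+_ (cong ind (∨-identityʳ (V fzero))) (card-insert (V ∘ fsuc) a) ⟩
    ind (V fzero) + (card (V ∘ fsuc) + ind (not (V (fsuc a))))
  ≡⟨ sym (+-assoc (ind (V fzero)) _ _) ⟩
    ind (V fzero) + card (V ∘ fsuc) + ind (not (V (fsuc a)))
  ≡⟨ cong (_+ ind (not (V (fsuc a)))) (sym (∑-allFin-suc ℓ (ind ∘ V))) ⟩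
    card V + ind (not (V (fsuc a)))
  ∎

card+card-not : ∀ ℓ (V : ColourSet ℓ) → card V + card (not ∘ V) ≡ ℓ
card+card-not zero V = refl
card+card-not (suc ℓ) V =
  trans (cong₂ _+_ (∑-allFin-suc ℓ (ind ∘ V)) (∑-allFin-suc ℓ (ind ∘ not ∘ V)))
   (trans (count (V fzero) (card (V ∘ fsuc)) (card (not ∘ V ∘ fsuc))) (cong suc (card+card-not ℓ (V ∘ fsuc))))
  where
  count : ∀ b x y → ind b + x + (ind (not b) + y) ≡ suc (x + y)
  count true x y = refl
  count false x y = +-suc x y

card≤ : ∀ ℓ (V : ColourSet ℓ) → card V ≤ ℓ
card≤ ℓ V = subst (card V ≤_) (card+card-not ℓ V) (m≤m+n _ _)

∑-select : ∀ {ℓ} (a : Fin ℓ) (f : Fin ℓ → ℕ) → ∑ (allFin ℓ) (λ t → ind (finEqᵇ a t) * f t) ≡ f a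
∑-select {suc ℓ} fzero f = begin
    ∑ (allFin (suc ℓ)) (λ t → ind (finEqᵇ fzero t) * f t)
  ≡⟨ ∑-allFin-suc ℓ _ ⟩
    (f fzero + 0) + ∑ (allFin ℓ) (λ t → 0 * f (fsuc t))
  ≡⟨ cong₂ _+_ (+-identityʳ (f fzero)) (∑-zero (allFin ℓ) (λ _ → refl)) ⟩
    f fzero + 0
  ≡⟨ +-identityʳ (f fzero) ⟩
    f fzero
  ∎
∑-select {suc ℓ} (fsuc a) f = trans (∑-allFin-suc ℓ (λ t → ind (finEqᵇ (fsuc a) t) * f t)) (∑-select a (f ∘ fsuc))

isZero : ℕ → ℕ
isZero zero = 1
isZero (suc _) = 0

covers-[] : ∀ ℓ (V : ColourSet ℓ) → ind (covers V []) ≡ isZero (ℓ ∸ card V)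
covers-[] zero V = refl
covers-[] (suc ℓ) V rewrite all-allFin-suc ℓ (λ t → V t ∨ false) | ∑-allFin-suc ℓ (ind ∘ V) with V fzero
... | true = covers-[] ℓ (V ∘ fsuc)
... | false = cong isZero (sym (+-∸-assoc 1 (card≤ ℓ (V ∘ fsuc))))

ind-∧-middle : ∀ x o r → ind (x ∧ (o ∧ r)) ≡ ind o * ind (x ∧ r)
ind-∧-middle true true r = sym (+-identityʳ _)
ind-∧-middle true false r = refl
ind-∧-middle false true r = refl
ind-∧-middle false false r = refl

scaled-rStirling-suc : ∀ n s k k' → pred k ≡ k' →
  k ! * rStirling (suc n) s k ≡ s * (k ! * rStirling n s k) + k * (k' ! * rStirling n (suc s) k')
scaled-rStirling-suc n s zero k' _ = expand s (s ^ n)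
  where
  expand : ∀ s x → 1 * (s * x) ≡ s * (1 * x) + 0
  expand = solve-∀
scaled-rStirling-suc n s (suc k) .k refl = expand s k (k !) (rStirling n s (suc k)) (rStirling n (suc s) k)
  where
  expand : ∀ s k f x y → (suc k * f) * (s * x + y) ≡ s * ((suc k * f) * x) + suc k * (f * y)
  expand = solve-∀

scaled-rStirling-zero : ∀ k s → k ! * rStirling 0 s k ≡ isZero k
scaled-rStirling-zero zero s = refl
scaled-rStirling-zero (suc k) s = *-zeroʳ (suc k !)

module Counting (ℓ : ℕ) where

  coloured : ℕ → ColourSet ℓ → Fin ℓ → ℕ
  coloured n U a = ∑ (allBoolVecs n) (λ v → ∑ (allVecs ℓ n) (λ c →
    ind (covers U (a ∷ toList c) ∧ compatible v (toℕ a ∷ colours c))))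

  -- Its closed form in terms of the number u of colours already used.
  closed : ℕ → ℕ → ℕ
  closed n u = (ℓ ∸ u) ! * rStirling n (suc u) (ℓ ∸ u)

  closed-suc : ∀ n u → closed (suc n) u ≡ suc u * closed n u + (ℓ ∸ u) * closed n (suc u)
  closed-suc n u = scaled-rStirling-suc n (suc u) (ℓ ∸ u) (ℓ ∸ suc u) (pred[m∸n]≡m∸[1+n] ℓ u)

  closed-step : ∀ n u b → closed n (u + ind (not b)) ≡ ind b * closed n u + ind (not b) * closed n (suc u)
  closed-step n u true = trans (cong (closed n) (+-identityʳ u)) (pick (closed n u) (closed n (suc u)))
    where
    pick : ∀ x y → x ≡ 1 * x + 0 * y
    pick = solve-∀
  closed-step n u false = trans (cong (closed n) (+-comm u 1)) (pick (closed n u) (closed n (suc u)))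
    where
    pick : ∀ x y → y ≡ 0 * x + 1 * y
    pick = solve-∀

  -- Removing the first step: the next colour a' may follow a in
  -- 1 + [a = a'] orientations.
  coloured-suc : ∀ n U a →
    coloured (suc n) U a ≡ ∑ (allFin ℓ) (λ a' → suc (ind (finEqᵇ a a')) * coloured n (insert U a) a')
  coloured-suc n U a = begin
      coloured (suc n) U a
    ≡⟨ unfold ⟩
      ∑ bs (λ b → ∑ (allBoolVecs n) (λ v → ∑ (allFin ℓ) (λ a' → ∑ (allVecs ℓ n) (λ c → term (b ∷ v) (a' ∷ c)))))
    ≡⟨ ∑-cong bs (λ b → trans (∑-cong (allBoolVecs n) (λ v → ∑-cong (allFin ℓ) (λ a' → factor b v a'))) (swap b)) ⟩
      ∑ bs (λ b → ∑ (allFin ℓ) (λ a' → orient b a' * coloured n (insert U a) a'))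
    ≡⟨ orientations ⟩
      ∑ (allFin ℓ) (λ a' → suc (ind (finEqᵇ a a')) * coloured n (insert U a) a')
    ∎
    where
    bs : List Bool
    bs = true ∷ false ∷ []
    term : ∀ {m} → Vec Bool m → Vec (Fin ℓ) m → ℕ
    term v c = ind (covers U (a ∷ toList c) ∧ compatible v (toℕ a ∷ colours c))
    orient : Bool → Fin ℓ → ℕ
    orient b a' = ind (ordered b (toℕ a) (toℕ a'))
    rest : Vec Bool n → Fin ℓ → ℕ
    rest v a' = ∑ (allVecs ℓ n) (λ c → ind (covers (insert U a) (a' ∷ toList c) ∧ compatible v (toℕ a' ∷ colours c)))
    unfold : coloured (suc n) U a
           ≡ ∑ bs (λ b → ∑ (allBoolVecs n) (λ v → ∑ (allFin ℓ) (λ a' → ∑ (allVecs ℓ n) (λ c → term (b ∷ v) (a' ∷ c)))))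
    unfold = trans (∑-concatMap bs (λ b → map (b ∷_) (allBoolVecs n)) (λ v → ∑ (allVecs ℓ (suc n)) (term v)))
      (∑-cong bs λ b → trans (∑-map (allBoolVecs n) (b ∷_) (λ v → ∑ (allVecs ℓ (suc n)) (term v)))
        (∑-cong (allBoolVecs n) λ v → trans (∑-concatMap (allFin ℓ) (λ t → map (t ∷_) (allVecs ℓ n)) (term (b ∷ v)))
          (∑-cong (allFin ℓ) λ a' → ∑-map (allVecs ℓ n) (a' ∷_) (term (b ∷ v)))))
    factor : ∀ b v a' → ∑ (allVecs ℓ n) (λ c → term (b ∷ v) (a' ∷ c)) ≡ orient b a' * rest v a'
    factor b v a' = trans (∑-cong (allVecs ℓ n) (λ c →
        trans (cong (λ X → ind (X ∧ (ordered b (toℕ a) (toℕ a') ∧ compatible v (toℕ a' ∷ colours c)))) (covers-∷ U a (a' ∷ toList c)))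
              (ind-∧-middle (covers (insert U a) (a' ∷ toList c)) (ordered b (toℕ a) (toℕ a')) (compatible v (toℕ a' ∷ colours c)))))
      (∑-*ˡ (allVecs ℓ n) (orient b a') (λ c → ind (covers (insert U a) (a' ∷ toList c) ∧ compatible v (toℕ a' ∷ colours c))))
    swap : ∀ b → ∑ (allBoolVecs n) (λ v → ∑ (allFin ℓ) (λ a' → orient b a' * rest v a'))
               ≡ ∑ (allFin ℓ) (λ a' → orient b a' * coloured n (insert U a) a')
    swap b = trans (∑-swap (allBoolVecs n) (allFin ℓ) (λ v a' → orient b a' * rest v a'))
      (∑-cong (allFin ℓ) λ a' → ∑-*ˡ (allBoolVecs n) (orient b a') (λ v → rest v a'))
    along : Bool → ℕ
    along b = ∑ (allFin ℓ) (λ a' → orient b a' * coloured n (insert U a) a')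
    orientations : ∑ bs (λ b → ∑ (allFin ℓ) (λ a' → orient b a' * coloured n (insert U a) a'))
                 ≡ ∑ (allFin ℓ) (λ a' → suc (ind (finEqᵇ a a')) * coloured n (insert U a) a')
    orientations = trans (cong (along true +_) (+-identityʳ (along false)))
      (trans (sym (∑-+ (allFin ℓ) (λ a' → orient true a' * coloured n (insert U a) a') (λ a' → orient false a' * coloured n (insert U a) a')))
        (∑-cong (allFin ℓ) λ a' →
        trans (sym (*-distribʳ-+ (coloured n (insert U a) a') (orient true a') (orient false a')))
              (cong (_* coloured n (insert U a) a') (ordered-both (toℕ a) (toℕ a')))))

  coloured≡closed : ∀ n U a → coloured n U a ≡ closed n (card (insert U a))
  coloured≡closed zero U a = begin
      ind (covers U (a ∷ []) ∧ true) + 0 + 0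
    ≡⟨ trans (+-identityʳ _) (trans (+-identityʳ _) (cong ind (∧-identityʳ _))) ⟩
      ind (covers U (a ∷ []))
    ≡⟨ cong ind (covers-∷ U a []) ⟩
      ind (covers (insert U a) [])
    ≡⟨ covers-[] ℓ (insert U a) ⟩
      isZero (ℓ ∸ card (insert U a))
    ≡⟨ sym (scaled-rStirling-zero (ℓ ∸ card (insert U a)) _) ⟩
      closed zero (card (insert U a))
    ∎
  coloured≡closed (suc n) U a = begin
      coloured (suc n) U a
    ≡⟨ coloured-suc n U a ⟩
      ∑ (allFin ℓ) (λ a' → suc (ind (finEqᵇ a a')) * coloured n U' a')
    ≡⟨ ∑-cong (allFin ℓ) (λ a' → cong (suc (ind (finEqᵇ a a')) *_) (coloured≡closed n U' a')) ⟩
      ∑ (allFin ℓ) (λ a' → closed n (card (insert U' a')) + ind (finEqᵇ a a') * closed n (card (insert U' a')))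
    ≡⟨ ∑-+ (allFin ℓ) _ _ ⟩
      ∑ (allFin ℓ) (λ a' → closed n (card (insert U' a'))) + ∑ (allFin ℓ) (λ a' → ind (finEqᵇ a a') * closed n (card (insert U' a')))
    ≡⟨ cong₂ _+_ nextColour (trans (∑-select a _) (cong (closed n) again)) ⟩
      u * closed n u + card (not ∘ U') * closed n (suc u) + closed n u
    ≡⟨ cong (λ c → u * closed n u + c * closed n (suc u) + closed n u) (sym unused) ⟩
      u * closed n u + (ℓ ∸ u) * closed n (suc u) + closed n u
    ≡⟨ regroup u (closed n u) (ℓ ∸ u) (closed n (suc u)) ⟩
      suc u * closed n u + (ℓ ∸ u) * closed n (suc u)
    ≡⟨ sym (closed-suc n u) ⟩
      closed (suc n) u
    ∎
    where
    U' : ColourSet ℓ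
    U' = insert U a
    u : ℕ
    u = card U'
    -- The next colour is either one of the u used colours or a new one.
    nextColour : ∑ (allFin ℓ) (λ a' → closed n (card (insert U' a'))) ≡ u * closed n u + card (not ∘ U') * closed n (suc u)
    nextColour = trans (∑-cong (allFin ℓ) (λ a' → trans (cong (closed n) (card-insert U' a')) (closed-step n u (U' a'))))
      (trans (∑-+ (allFin ℓ) _ _)
        (cong₂ _+_ (∑-*ʳ (allFin ℓ) (closed n u) (ind ∘ U')) (∑-*ʳ (allFin ℓ) (closed n (suc u)) (ind ∘ not ∘ U'))))
    again : card (insert U' a) ≡ u
    again = trans (card-insert U' a)
      (trans (cong (λ b → u + ind (not b)) (trans (cong (U a ∨_) (≡ᵇ-refl (toℕ a))) (∨-zeroʳ (U a)))) (+-identityʳ u))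
    unused : ℓ ∸ u ≡ card (not ∘ U')
    unused = trans (cong (_∸ u) (sym (card+card-not ℓ U'))) (m+n∸m≡n u (card (not ∘ U')))
    regroup : ∀ u x c y → u * x + c * y + x ≡ suc u * x + c * y
    regroup = solve-∀

  compatibleSurjections : ℕ → ℕ
  compatibleSurjections n = ∑ (allBoolVecs n) (λ v →
    length (boolFilter (λ c → surjectiveᵇ c ∧ compatible v (colours c)) (allVecs ℓ (suc n))))

  -- Counting by the first colour: after it, one colour is used.
  compatibleSurjections≡ : ∀ n → compatibleSurjections n ≡ ℓ * closed n 1
  compatibleSurjections≡ n = begin
      compatibleSurjections n
    ≡⟨ ∑-cong (allBoolVecs n) firstColour ⟩
      ∑ (allBoolVecs n) (λ v → ∑ (allFin ℓ) (λ a → term v a))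
    ≡⟨ ∑-swap (allBoolVecs n) (allFin ℓ) term ⟩
      ∑ (allFin ℓ) (coloured n ∅)
    ≡⟨ ∑-cong (allFin ℓ) (λ a → trans (coloured≡closed n ∅ a) (cong (closed n) (single a))) ⟩
      ∑ (allFin ℓ) (λ _ → closed n 1)
    ≡⟨ trans (∑-const (allFin ℓ) (closed n 1)) (cong (_* closed n 1) (length-allFin ℓ)) ⟩
      ℓ * closed n 1
    ∎
    where
    term : Vec Bool n → Fin ℓ → ℕ
    term v a = ∑ (allVecs ℓ n) (λ c → ind (covers ∅ (a ∷ toList c) ∧ compatible v (toℕ a ∷ colours c)))
    firstColour : ∀ v → length (boolFilter (λ c → surjectiveᵇ c ∧ compatible v (colours c)) (allVecs ℓ (suc n)))
                      ≡ ∑ (allFin ℓ) (term v)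
    firstColour v = trans (length-filter _ (allVecs ℓ (suc n)))
      (trans (∑-concatMap (allFin ℓ) (λ t → map (t ∷_) (allVecs ℓ n)) _)
        (∑-cong (allFin ℓ) (λ a → ∑-map (allVecs ℓ n) (a ∷_) _)))
    single : ∀ a → card (insert ∅ a) ≡ 1
    single a = trans (card-insert ∅ a) (cong (_+ 1) (∑-zero (allFin ℓ) (λ _ → refl)))

endpointsOn : ℕ → Edge → ℕ
endpointsOn p (x , y , a , b) = [ x == p ] + [ y == p ]

pegCount-∑ : ∀ p D → pegCount p D ≡ ∑ D (endpointsOn p)
pegCount-∑ p [] = refl
pegCount-∑ p ((x , y , a , b) ∷ D) = cong ([ x == p ] + [ y == p ] +_) (pegCount-∑ p D)

pegCount-++ : ∀ p A B → pegCount p (A ++ B) ≡ pegCount p A + pegCount p B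
pegCount-++ p A B = begin
    pegCount p (A ++ B)               ≡⟨ pegCount-∑ p (A ++ B) ⟩
    ∑ (A ++ B) (endpointsOn p)        ≡⟨ ∑-++ A B (endpointsOn p) ⟩
    ∑ A (endpointsOn p) + ∑ B (endpointsOn p) ≡⟨ sym (cong₂ _+_ (pegCount-∑ p A) (pegCount-∑ p B)) ⟩
    pegCount p A + pegCount p B       ∎

pegCount-reheight : ∀ p (h : Edge → Edge) → (∀ e → endpointsOn p (h e) ≡ endpointsOn p e) →
  ∀ X → pegCount p (map h X) ≡ pegCount p X
pegCount-reheight p h keeps X = begin
    pegCount p (map h X)          ≡⟨ pegCount-∑ p (map h X) ⟩
    ∑ (map h X) (endpointsOn p)   ≡⟨ ∑-map X h (endpointsOn p) ⟩
    ∑ X (endpointsOn p ∘ h)       ≡⟨ ∑-cong X keeps ⟩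
    ∑ X (endpointsOn p)           ≡⟨ sym (pegCount-∑ p X) ⟩
    pegCount p X                  ∎

pegCount-rel : ∀ p X → pegCount p (rel X) ≡ pegCount p X
pegCount-rel p X = pegCount-reheight p _ (λ { (x , y , a , b) → refl }) X

pegCount-⊕ : ∀ p A X → pegCount p (A ⊕ X) ≡ pegCount p A + pegCount p X
pegCount-⊕ p A X = trans (pegCount-++ p A _) (cong (pegCount p A +_) (pegCount-reheight p _ (λ { (x , y , a , b) → refl }) X))

∑-edges-filter : {A : Set} (q : Edge × A → Bool) (f : Edge → ℕ) (L : List (Edge × A)) →
  ∑ (map proj₁ (boolFilter q L)) f ≡ ∑ L (λ z → ind (q z) * f (proj₁ z))
∑-edges-filter q f [] = refl
∑-edges-filter q f (z ∷ L) with q z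
... | true = cong₂ _+_ (sym (+-identityʳ _)) (∑-edges-filter q f L)
... | false = ∑-edges-filter q f L

all-edges-filter : {A : Set} (P : Edge → Bool) (q : Edge × A → Bool) (L : List (Edge × A)) →
  all P (map proj₁ (boolFilter q L)) ≡ all (λ z → not (q z) ∨ P (proj₁ z)) L
all-edges-filter P q [] = refl
all-edges-filter P q (z ∷ L) with q z
... | true = cong (P (proj₁ z) ∧_) (all-edges-filter P q L)
... | false = all-edges-filter P q L

pegCount-filter : ∀ p (q : Edge × ℕ → Bool) (L : List (Edge × ℕ)) →
  pegCount p (map proj₁ (boolFilter q L)) ≡ ∑ L (λ z → ind (q z) * endpointsOn p (proj₁ z))
pegCount-filter p q L = trans (pegCount-∑ p (map proj₁ (boolFilter q L))) (∑-edges-filter q (endpointsOn p) L)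

-- A diagram whose edges carry colours 0, 1, 2, … is reconstructed layer by
-- layer: each colour class is relabelled and stacked on top of the layers
-- of smaller colour.  An edge of colour s is therefore placed at its rank
-- within its layer, shifted by the endpoints of smaller colour on its peg.
module Layers (colouredEdges : List (Edge × ℕ)) where

  layer : ℕ → Diagram
  layer s = map proj₁ (boolFilter (λ z → proj₂ z ≡ᵇ s) colouredEdges)

  below : ℕ → Diagram
  below s = map proj₁ (boolFilter (λ z → proj₂ z <ᵇ s) colouredEdges)

  placed : ℕ → Edge → Edge
  placed s (x , y , a , b) =
    (x , y , rank x a (layer s) + pegCount x (below s) , rank y b (layer s) + pegCount y (below s))

  below-suc : ∀ p s → pegCount p (below s) + pegCount p (layer s) ≡ pegCount p (below (suc s))
  below-suc p s = begin
      pegCount p (below s) + pegCount p (layer s)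
    ≡⟨ cong₂ _+_ (pegCount-filter p _ colouredEdges) (pegCount-filter p _ colouredEdges) ⟩
      ∑ colouredEdges (λ z → ind (proj₂ z <ᵇ s) * endpointsOn p (proj₁ z))
        + ∑ colouredEdges (λ z → ind (proj₂ z ≡ᵇ s) * endpointsOn p (proj₁ z))
    ≡⟨ sym (∑-+ colouredEdges _ _) ⟩
      ∑ colouredEdges (λ z → ind (proj₂ z <ᵇ s) * endpointsOn p (proj₁ z) + ind (proj₂ z ≡ᵇ s) * endpointsOn p (proj₁ z))
    ≡⟨ ∑-cong colouredEdges (λ z → trans (sym (*-distribʳ-+ (endpointsOn p (proj₁ z)) (ind (proj₂ z <ᵇ s)) (ind (proj₂ z ≡ᵇ s))))
                              (cong (_* endpointsOn p (proj₁ z)) (sym (ind-<ᵇ-suc (proj₂ z) s)))) ⟩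
      ∑ colouredEdges (λ z → ind (proj₂ z <ᵇ suc s) * endpointsOn p (proj₁ z))
    ≡⟨ sym (pegCount-filter p _ colouredEdges) ⟩
      pegCount p (below (suc s))
    ∎

  below-zero : ∀ p → pegCount p (below 0) ≡ 0
  below-zero p = trans (pegCount-filter p _ colouredEdges) (∑-zero colouredEdges (λ _ → refl))

  all-stack : ∀ (Q : Edge → Bool) r a A → (∀ p → pegCount p A ≡ pegCount p (below a)) →
    all Q (foldl _⊕_ A (map (rel ∘ layer) (range a r)))
      ≡ all Q A ∧ all (λ s → all (Q ∘ placed s) (layer s)) (range a r)
  all-stack Q zero a A _ = sym (∧-identityʳ _)
  all-stack Q (suc r) a A heightA = begin
      all Q (foldl _⊕_ (A ⊕ rel (layer a)) (map (rel ∘ layer) (range (suc a) r)))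
    ≡⟨ all-stack Q r (suc a) (A ⊕ rel (layer a)) heightA' ⟩
      all Q (A ⊕ rel (layer a)) ∧ rest
    ≡⟨ cong (_∧ rest) stackOne ⟩
      (all Q A ∧ all (Q ∘ placed a) (layer a)) ∧ rest
    ≡⟨ ∧-assoc (all Q A) _ _ ⟩
      all Q A ∧ (all (Q ∘ placed a) (layer a) ∧ rest)
    ∎
    where
    rest : Bool
    rest = all (λ s → all (Q ∘ placed s) (layer s)) (range (suc a) r)
    heightA' : ∀ p → pegCount p (A ⊕ rel (layer a)) ≡ pegCount p (below (suc a))
    heightA' p = trans (pegCount-⊕ p A _) (trans (cong₂ _+_ (heightA p) (pegCount-rel p (layer a))) (below-suc p a))
    stackOne : all Q (A ⊕ rel (layer a)) ≡ all Q A ∧ all (Q ∘ placed a) (layer a)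
    stackOne = trans (all-++ Q A _) (cong (all Q A ∧_)
      (trans (all-map Q _ (rel (layer a))) (trans (all-map _ _ (layer a))
        (all-cong (layer a) λ { (x , y , a' , b') →
          cong₂ (λ u w → Q (x , y , rank x a' (layer a) + u , rank y b' (layer a) + w)) (heightA x) (heightA y) }))))

  all-layers : ∀ (Q : Edge → Bool) ℓ →
    all Q (foldl _⊕_ [] (map (rel ∘ layer) (range 0 ℓ))) ≡ all (λ s → all (Q ∘ placed s) (layer s)) (range 0 ℓ)
  all-layers Q ℓ = all-stack Q ℓ 0 [] (λ p → sym (below-zero p))

colourClass-toℕ : ∀ {ℓ} (D : Diagram) (xs : List (Fin ℓ)) s →
  map proj₁ (boolFilter (λ p → toℕ (proj₂ p) ≡ᵇ s) (zip D xs)) ≡ map proj₁ (boolFilter (λ p → proj₂ p ≡ᵇ s) (zip D (map toℕ xs)))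
colourClass-toℕ [] xs s = refl
colourClass-toℕ (d ∷ D) [] s = refl
colourClass-toℕ (d ∷ D) (x ∷ xs) s with toℕ x ≡ᵇ s
... | true = cong (d ∷_) (colourClass-toℕ D xs s)
... | false = colourClass-toℕ D xs s

reconstruct-layers : ∀ {ℓ} (D : Diagram) (c : Vec (Fin ℓ) (length D)) →
  reconstruct D c ≡ foldl _⊕_ [] (map (rel ∘ Layers.layer (zip D (colours c))) (range 0 ℓ))
reconstruct-layers {ℓ} D c = cong (foldl _⊕_ [])
  (trans (map-cong (λ t → cong rel (colourClass-toℕ D (toList c) (toℕ t))) (allFin ℓ))
   (trans (map-∘ {g = rel ∘ Layers.layer (zip D (colours c))} {f = toℕ} (allFin ℓ)) (cong (map _) (toℕ-allFin ℓ))))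

endpointsBelow : ℕ → ℕ → Edge → ℕ
endpointsBelow p h (x , y , a , b) = ind (x ≡ᵇ p) * ind (a ≤ᵇ h) + ind (y ≡ᵇ p) * ind (b ≤ᵇ h)

rank-∑ : ∀ p h X → rank p h X ≡ ∑ X (endpointsBelow p h)
rank-∑ p h X = trans (length-filter (λ h' → h' ≤ᵇ h) (heightsOn p X))
  (trans (∑-concatMap X endpointHeights (ind ∘ (λ h' → h' ≤ᵇ h))) (∑-cong X perEdge))
  where
  endpointHeights : Edge → List ℕ
  endpointHeights (x , y , a , b) = (if x ≡ᵇ p then a ∷ [] else []) ++ (if y ≡ᵇ p then b ∷ [] else [])
  perEdge : ∀ e → ∑ (endpointHeights e) (λ h' → ind (h' ≤ᵇ h)) ≡ endpointsBelow p h e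
  perEdge (x , y , a , b) with x ≡ᵇ p | y ≡ᵇ p
  ... | true | true = both (ind (a ≤ᵇ h)) (ind (b ≤ᵇ h))
    where
    both : ∀ A B → A + (B + 0) ≡ 1 * A + 1 * B
    both = solve-∀
  ... | true | false = left (ind (a ≤ᵇ h)) (ind (b ≤ᵇ h))
    where
    left : ∀ A B → A + 0 ≡ 1 * A + 0 * B
    left = solve-∀
  ... | false | true = right (ind (a ≤ᵇ h)) (ind (b ≤ᵇ h))
    where
    right : ∀ A B → B + 0 ≡ 0 * A + 1 * B
    right = solve-∀
  ... | false | false = refl

[==]≡ind : ∀ x y → [ x == y ] ≡ ind (x ≡ᵇ y)
[==]≡ind x y with x ≡ᵇ y
... | true = refl
... | false = refl

-- under c c' h h' is 1 if an endpoint of colour c' at height h' is placed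
-- below an endpoint of colour c at height h on the same peg, else 0.
under : ℕ → ℕ → ℕ → ℕ → ℕ
under c c' h h' = ind (c' ≡ᵇ c) * ind (h' ≤ᵇ h) + ind (c' <ᵇ c)

-- A path diagram: edges E k from peg i+k (height X k) to peg i+k+1
-- (height Y k) for k < m, where edge k carries colour cf k.
module Path (i m : ℕ) (X Y cf : ℕ → ℕ) where

  E : ℕ → Edge
  E k = (i + k , suc (i + k) , X k , Y k)

  edges : List (Edge × ℕ)
  edges = map (λ k → (E k , cf k)) (range 0 m)

  open Layers edges public

  newLeft newRight : ℕ → ℕ
  newLeft k = rank (i + k) (X k) (layer (cf k)) + pegCount (i + k) (below (cf k))
  newRight k = rank (suc (i + k)) (Y k) (layer (cf k)) + pegCount (suc (i + k)) (below (cf k))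

  -- A quantity on peg i+q collects the left end of edge q (via U) and the
  -- right end of edge q-1 (via V).
  atPeg : ℕ → (ℕ → ℕ) → (ℕ → ℕ) → ℕ
  atPeg q U V = ∑ (range 0 m) (λ k → ind (k ≡ᵇ q) * U k + ind (suc k ≡ᵇ q) * V k)

  atPeg-split : ∀ q U V → atPeg q U V ≡ ∑ (range 0 m) (λ k → ind (k ≡ᵇ q) * U k) + ∑ (range 0 m) (λ k → ind (suc k ≡ᵇ q) * V k)
  atPeg-split q U V = ∑-+ (range 0 m) (λ k → ind (k ≡ᵇ q) * U k) (λ k → ind (suc k ≡ᵇ q) * V k)

  atPeg-first : ∀ U V → 0 < m → atPeg 0 U V ≡ U 0
  atPeg-first U V 0<m = begin
      atPeg 0 U V
    ≡⟨ atPeg-split 0 U V ⟩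
      ∑ (range 0 m) (λ k → ind (k ≡ᵇ 0) * U k) + ∑ (range 0 m) (λ k → ind (suc k ≡ᵇ 0) * V k)
    ≡⟨ cong₂ _+_ (∑-range-select 0 m 0 U z≤n 0<m) (∑-zero (range 0 m) (λ _ → refl)) ⟩
      U 0 + 0
    ≡⟨ +-identityʳ _ ⟩
      U 0
    ∎

  atPeg-inner : ∀ U V j → suc j < m → atPeg (suc j) U V ≡ U (suc j) + V j
  atPeg-inner U V j j+1<m = trans (atPeg-split (suc j) U V)
    (cong₂ _+_ (∑-range-select 0 m (suc j) U z≤n j+1<m) (∑-range-select 0 m j V z≤n (<-trans (n<1+n j) j+1<m)))

  atPeg-last : ∀ U V n → m ≡ suc n → atPeg (suc n) U V ≡ V n
  atPeg-last U V n refl = trans (atPeg-split (suc n) U V)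
    (cong₂ _+_ (∑-range-miss 0 m (suc n) U (inj₂ ≤-refl)) (∑-range-select 0 m n V z≤n ≤-refl))

  leftOnPeg : ∀ k q → (i + k ≡ᵇ i + q) ≡ (k ≡ᵇ q)
  leftOnPeg k q = ≡ᵇ-cancelˡ i k q

  rightOnPeg : ∀ k q → (suc (i + k) ≡ᵇ i + q) ≡ (suc k ≡ᵇ q)
  rightOnPeg k q = trans (cong (_≡ᵇ i + q) (sym (+-suc i k))) (≡ᵇ-cancelˡ i (suc k) q)

  rank-atPeg : ∀ q h t →
    rank (i + q) h (layer t) ≡ atPeg q (λ k → ind (cf k ≡ᵇ t) * ind (X k ≤ᵇ h)) (λ k → ind (cf k ≡ᵇ t) * ind (Y k ≤ᵇ h))
  rank-atPeg q h t = begin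
      rank (i + q) h (layer t)
    ≡⟨ rank-∑ (i + q) h (layer t) ⟩
      ∑ (layer t) (endpointsBelow (i + q) h)
    ≡⟨ ∑-edges-filter (λ z → proj₂ z ≡ᵇ t) (endpointsBelow (i + q) h) edges ⟩
      ∑ edges (λ z → ind (proj₂ z ≡ᵇ t) * endpointsBelow (i + q) h (proj₁ z))
    ≡⟨ ∑-map (range 0 m) (λ k → (E k , cf k)) (λ z → ind (proj₂ z ≡ᵇ t) * endpointsBelow (i + q) h (proj₁ z)) ⟩
      ∑ (range 0 m) (λ k → ind (cf k ≡ᵇ t) * endpointsBelow (i + q) h (E k))
    ≡⟨ ∑-cong (range 0 m) perEdge ⟩
      atPeg q (λ k → ind (cf k ≡ᵇ t) * ind (X k ≤ᵇ h)) (λ k → ind (cf k ≡ᵇ t) * ind (Y k ≤ᵇ h))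
    ∎
    where
    distribute : ∀ a e₁ b e₂ c → a * (e₁ * b + e₂ * c) ≡ e₁ * (a * b) + e₂ * (a * c)
    distribute = solve-∀
    perEdge : ∀ k → ind (cf k ≡ᵇ t) * endpointsBelow (i + q) h (E k)
                  ≡ ind (k ≡ᵇ q) * (ind (cf k ≡ᵇ t) * ind (X k ≤ᵇ h)) + ind (suc k ≡ᵇ q) * (ind (cf k ≡ᵇ t) * ind (Y k ≤ᵇ h))
    perEdge k = trans (cong₂ (λ u w → ind (cf k ≡ᵇ t) * (ind u * ind (X k ≤ᵇ h) + ind w * ind (Y k ≤ᵇ h)))
                             (leftOnPeg k q) (rightOnPeg k q))
                      (distribute (ind (cf k ≡ᵇ t)) (ind (k ≡ᵇ q)) (ind (X k ≤ᵇ h)) (ind (suc k ≡ᵇ q)) (ind (Y k ≤ᵇ h)))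

  pegCount-atPeg : ∀ q t → pegCount (i + q) (below t) ≡ atPeg q (λ k → ind (cf k <ᵇ t)) (λ k → ind (cf k <ᵇ t))
  pegCount-atPeg q t = begin
      pegCount (i + q) (below t)
    ≡⟨ pegCount-filter (i + q) (λ z → proj₂ z <ᵇ t) edges ⟩
      ∑ edges (λ z → ind (proj₂ z <ᵇ t) * endpointsOn (i + q) (proj₁ z))
    ≡⟨ ∑-map (range 0 m) (λ k → (E k , cf k)) (λ z → ind (proj₂ z <ᵇ t) * endpointsOn (i + q) (proj₁ z)) ⟩
      ∑ (range 0 m) (λ k → ind (cf k <ᵇ t) * endpointsOn (i + q) (E k))
    ≡⟨ ∑-cong (range 0 m) perEdge ⟩
      atPeg q (λ k → ind (cf k <ᵇ t)) (λ k → ind (cf k <ᵇ t))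
    ∎
    where
    distribute : ∀ a e₁ e₂ → a * (e₁ + e₂) ≡ e₁ * a + e₂ * a
    distribute = solve-∀
    perEdge : ∀ k → ind (cf k <ᵇ t) * endpointsOn (i + q) (E k) ≡ ind (k ≡ᵇ q) * ind (cf k <ᵇ t) + ind (suc k ≡ᵇ q) * ind (cf k <ᵇ t)
    perEdge k = trans (cong₂ (λ u w → ind (cf k <ᵇ t) * (u + w))
                             (trans ([==]≡ind (i + k) (i + q)) (cong ind (leftOnPeg k q)))
                             (trans ([==]≡ind (suc (i + k)) (i + q)) (cong ind (rightOnPeg k q))))
                      (distribute (ind (cf k <ᵇ t)) (ind (k ≡ᵇ q)) (ind (suc k ≡ᵇ q)))

  private
    self : ∀ c h → ind (c ≡ᵇ c) * ind (h ≤ᵇ h) ≡ 1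
    self c h rewrite ≡ᵇ-refl c | ≤ᵇ-refl h = refl

    notBelowSelf : ∀ c → ind (c <ᵇ c) ≡ 0
    notBelowSelf c = cong ind (<ᵇ-irrefl c)

  -- The two outer endpoints are alone on their pegs.
  newLeft-first : 0 < m → newLeft 0 ≡ 1
  newLeft-first 0<m = cong₂ _+_
    (trans (rank-atPeg 0 (X 0) (cf 0)) (trans (atPeg-first _ (λ k → ind (cf k ≡ᵇ cf 0) * ind (Y k ≤ᵇ X 0)) 0<m) (self (cf 0) (X 0))))
    (trans (pegCount-atPeg 0 (cf 0)) (trans (atPeg-first _ (λ k → ind (cf k <ᵇ cf 0)) 0<m) (notBelowSelf (cf 0))))

  newRight-last : ∀ n → m ≡ suc n → newRight n ≡ 1
  newRight-last n m≡ = begin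
      newRight n
    ≡⟨ cong (λ p → rank p (Y n) (layer (cf n)) + pegCount p (below (cf n))) (sym (+-suc i n)) ⟩
      rank (i + suc n) (Y n) (layer (cf n)) + pegCount (i + suc n) (below (cf n))
    ≡⟨ cong₂ _+_ (trans (rank-atPeg (suc n) (Y n) (cf n)) (trans (atPeg-last _ _ n m≡) (self (cf n) (Y n))))
                 (trans (pegCount-atPeg (suc n) (cf n)) (trans (atPeg-last _ _ n m≡) (notBelowSelf (cf n)))) ⟩
      1
    ∎

  -- An inner peg carries the right end of edge j and the left end of edge
  -- j+1; each is placed one above the other if that one is below it.
  newRight-inner : ∀ j → suc j < m → newRight j ≡ suc (under (cf j) (cf (suc j)) (Y j) (X (suc j)))
  newRight-inner j j+1<m = begin
      newRight j
    ≡⟨ cong (λ p → rank p (Y j) (layer (cf j)) + pegCount p (below (cf j))) (sym (+-suc i j)) ⟩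
      rank (i + suc j) (Y j) (layer (cf j)) + pegCount (i + suc j) (below (cf j))
    ≡⟨ cong₂ _+_ (trans (rank-atPeg (suc j) (Y j) (cf j)) (atPeg-inner _ _ j j+1<m))
                 (trans (pegCount-atPeg (suc j) (cf j)) (atPeg-inner _ _ j j+1<m)) ⟩
      (A + ind (cf j ≡ᵇ cf j) * ind (Y j ≤ᵇ Y j)) + (B + ind (cf j <ᵇ cf j))
    ≡⟨ cong₂ (λ u w → (A + u) + (B + w)) (self (cf j) (Y j)) (notBelowSelf (cf j)) ⟩
      (A + 1) + (B + 0)
    ≡⟨ tidy A B ⟩
      suc (A + B)
    ∎
    where
    A B : ℕ
    A = ind (cf (suc j) ≡ᵇ cf j) * ind (X (suc j) ≤ᵇ Y j)
    B = ind (cf (suc j) <ᵇ cf j)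
    tidy : ∀ A B → (A + 1) + (B + 0) ≡ suc (A + B)
    tidy = solve-∀

  newLeft-inner : ∀ j → suc j < m → newLeft (suc j) ≡ suc (under (cf (suc j)) (cf j) (X (suc j)) (Y j))
  newLeft-inner j j+1<m = begin
      newLeft (suc j)
    ≡⟨ cong₂ _+_ (trans (rank-atPeg (suc j) (X (suc j)) (cf (suc j))) (atPeg-inner _ _ j j+1<m))
                 (trans (pegCount-atPeg (suc j) (cf (suc j))) (atPeg-inner _ _ j j+1<m)) ⟩
      (ind (cf (suc j) ≡ᵇ cf (suc j)) * ind (X (suc j) ≤ᵇ X (suc j)) + A) + (ind (cf (suc j) <ᵇ cf (suc j)) + B)
    ≡⟨ cong₂ (λ u w → (u + A) + (w + B)) (self (cf (suc j)) (X (suc j))) (notBelowSelf (cf (suc j))) ⟩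
      (1 + A) + (0 + B)
    ≡⟨ tidy A B ⟩
      suc (A + B)
    ∎
    where
    A B : ℕ
    A = ind (cf j ≡ᵇ cf (suc j)) * ind (Y j ≤ᵇ X (suc j))
    B = ind (cf j <ᵇ cf (suc j))
    tidy : ∀ A B → (1 + A) + (0 + B) ≡ suc (A + B)
    tidy = solve-∀

  member-path : ∀ k a b → k < m → memᵇ (i + k , suc (i + k) , a , b) (map E (range 0 m)) ≡ (a ≡ᵇ X k) ∧ (b ≡ᵇ Y k)
  member-path k a b k<m = begin
      memᵇ (i + k , suc (i + k) , a , b) (map E (range 0 m))
    ≡⟨ any-all _ (map E (range 0 m)) ⟩
      not (all (not ∘ edgeEqᵇ (i + k , suc (i + k) , a , b)) (map E (range 0 m)))
    ≡⟨ cong not (all-map _ E (range 0 m)) ⟩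
      not (all (λ k' → not (edgeEqᵇ (i + k , suc (i + k) , a , b) (E k'))) (range 0 m))
    ≡⟨ cong not (all-cong (range 0 m) λ k' → trans (cong (λ u → not (u ∧ u ∧ heights k')) (leftOnPeg k k'))
                                                   (nand (k ≡ᵇ k') (heights k'))) ⟩
      not (all (λ k' → not (k ≡ᵇ k') ∨ not (heights k')) (range 0 m))
    ≡⟨ cong not (all-range-select k 0 m (not ∘ heights) z≤n k<m) ⟩
      not (not (heights k))
    ≡⟨ not-involutive _ ⟩
      heights k
    ∎
    where
    heights : ℕ → Bool
    heights k' = (a ≡ᵇ X k') ∧ (b ≡ᵇ Y k')
    nand : ∀ e g → not (e ∧ e ∧ g) ≡ not e ∨ not g
    nand true g = refl
    nand false g = refl

  moved : ℕ → Edge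
  moved k = (i + k , suc (i + k) , newLeft k , newRight k)

  all-layers-by-edge : ∀ ℓ (Q : Edge → Bool) → (∀ k → k < m → cf k < ℓ) →
    all (λ s → all (Q ∘ placed s) (layer s)) (range 0 ℓ) ≡ all (Q ∘ moved) (range 0 m)
  all-layers-by-edge ℓ Q bound = begin
      all (λ s → all (Q ∘ placed s) (layer s)) (range 0 ℓ)
    ≡⟨ all-cong (range 0 ℓ) (λ s → trans (all-edges-filter (Q ∘ placed s) (λ z → proj₂ z ≡ᵇ s) edges)
                                         (all-map _ (λ k → (E k , cf k)) (range 0 m))) ⟩
      all (λ s → all (λ k → not (cf k ≡ᵇ s) ∨ Q (placed s (E k))) (range 0 m)) (range 0 ℓ)
    ≡⟨ all-swap (range 0 ℓ) (range 0 m) (λ s k → not (cf k ≡ᵇ s) ∨ Q (placed s (E k))) ⟩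
      all (λ k → all (λ s → not (cf k ≡ᵇ s) ∨ Q (placed s (E k))) (range 0 ℓ)) (range 0 m)
    ≡⟨ all-cong-range 0 m _ _ (λ k _ k<m → all-range-select (cf k) 0 ℓ (λ s → Q (placed s (E k))) z≤n (bound k k<m)) ⟩
      all (Q ∘ moved) (range 0 m)
    ∎

  path : Diagram
  path = map E (range 0 m)

  stays : Bool
  stays = all (λ k → (newLeft k ≡ᵇ X k) ∧ (newRight k ≡ᵇ Y k)) (range 0 m)

  same-as-path : (R : Diagram) → (∀ Q → all Q R ≡ all (Q ∘ moved) (range 0 m)) →
    sameDiagramᵇ R path ≡ stays
  same-as-path R allR = conclude (all (λ e → memᵇ e path) R) (all (λ e → memᵇ e R) path) R⊆path path⊆R
    where
    conclude : ∀ a b → a ≡ stays → (a ≡ true → b ≡ true) → (a ∧ b) ≡ stays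
    conclude true b a≡ b-holds rewrite b-holds refl = a≡
    conclude false b a≡ _ = a≡
    R⊆path : all (λ e → memᵇ e path) R ≡ stays
    R⊆path = trans (allR (λ e → memᵇ e path))
      (all-cong-range 0 m _ _ (λ k _ k<m → member-path k (newLeft k) (newRight k) k<m))
    moved≡E : stays ≡ true → ∀ k → k < m → moved k ≡ E k
    moved≡E h k k<m = cong₂ (λ a b → (i + k , suc (i + k) , a , b))
                            (≡ᵇ-true⇒≡ _ _ (∧-true-left _ _ atK)) (≡ᵇ-true⇒≡ _ _ (∧-true-right _ _ atK))
      where
      atK : ((newLeft k ≡ᵇ X k) ∧ (newRight k ≡ᵇ Y k)) ≡ true
      atK = all-range-elim 0 m _ h k z≤n k<m
    same-members : stays ≡ true → ∀ e → memᵇ e R ≡ memᵇ e path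
    same-members h e = begin
        memᵇ e R
      ≡⟨ any-all (edgeEqᵇ e) R ⟩
        not (all (not ∘ edgeEqᵇ e) R)
      ≡⟨ cong not (allR (not ∘ edgeEqᵇ e)) ⟩
        not (all (not ∘ edgeEqᵇ e ∘ moved) (range 0 m))
      ≡⟨ cong not (all-cong-range 0 m _ _ (λ k _ k<m → cong (not ∘ edgeEqᵇ e) (moved≡E h k k<m))) ⟩
        not (all (not ∘ edgeEqᵇ e ∘ E) (range 0 m))
      ≡⟨ cong not (sym (all-map (not ∘ edgeEqᵇ e) E (range 0 m))) ⟩
        not (all (not ∘ edgeEqᵇ e) path)
      ≡⟨ sym (any-all (edgeEqᵇ e) path) ⟩
        memᵇ e path
      ∎
    path⊆R : all (λ e → memᵇ e path) R ≡ true → all (λ e → memᵇ e R) path ≡ true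
    path⊆R h = begin
        all (λ e → memᵇ e R) path
      ≡⟨ all-cong path (same-members (trans (sym R⊆path) h)) ⟩
        all (λ e → memᵇ e path) path
      ≡⟨ all-map _ E (range 0 m) ⟩
        all (λ k → memᵇ (E k) path) (range 0 m)
      ≡⟨ all-cong-range 0 m _ (λ _ → true) (λ k _ k<m → trans (member-path k (X k) (Y k) k<m)
                                                             (cong₂ _∧_ (≡ᵇ-refl (X k)) (≡ᵇ-refl (Y k)))) ⟩
        all (λ _ → true) (range 0 m)
      ≡⟨ all-true (range 0 m) ⟩
        true
      ∎

leftHeight : ∀ {n} → ℕ → Vec Bool n → ℕ → ℕ
leftHeight xi v zero = xi
leftHeight xi [] (suc k) = 1
leftHeight xi (b ∷ v) (suc k) = leftHeight (bit b) v k

rightHeight : ∀ {n} → Vec Bool n → ℕ → ℕ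
rightHeight [] k = 1
rightHeight (b ∷ v) zero = other b
rightHeight (b ∷ v) (suc k) = rightHeight v k

choice : ∀ {n} → Vec Bool n → ℕ → Bool
choice [] k = true
choice (b ∷ v) zero = b
choice (b ∷ v) (suc k) = choice v k

rightHeight-last : ∀ {n} (v : Vec Bool n) → rightHeight v n ≡ 1
rightHeight-last [] = refl
rightHeight-last (b ∷ v) = rightHeight-last v

rightHeight-inner : ∀ {n} (v : Vec Bool n) j → j < n → rightHeight v j ≡ other (choice v j)
rightHeight-inner (b ∷ v) zero _ = refl
rightHeight-inner (b ∷ v) (suc j) (s≤s j<n) = rightHeight-inner v j j<n

leftHeight-inner : ∀ {n} xi (v : Vec Bool n) j → j < n → leftHeight xi v (suc j) ≡ bit (choice v j)
leftHeight-inner xi (b ∷ v) zero _ = refl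
leftHeight-inner xi (b ∷ v) (suc j) (s≤s j<n) = leftHeight-inner (bit b) v j j<n

webEdges-path : ∀ {n} i xi (v : Vec Bool n) →
  webEdges i xi v ≡ map (λ k → (i + k , suc (i + k) , leftHeight xi v k , rightHeight v k)) (range 0 (suc n))
webEdges-path i xi [] = cong (λ j → (j , suc j , xi , 1) ∷ []) (sym (+-identityʳ i))
webEdges-path {suc n} i xi (b ∷ v) = cong₂ _∷_ (cong (λ j → (j , suc j , xi , other b)) (sym (+-identityʳ i)))
  (trans (webEdges-path (suc i) (bit b) v)
   (trans (map-cong (λ k → cong (λ j → (j , suc j , leftHeight (bit b) v k , rightHeight v k)) (sym (+-suc i k))) (range 0 (suc n)))
    (trans (map-∘ {g = λ k → (i + k , suc (i + k) , leftHeight xi (b ∷ v) k , rightHeight (b ∷ v) k)} {f = suc} (range 0 (suc n)))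
     (cong (map _) (sym (range-suc 0 (suc n)))))))

length-web : ∀ {n} (v : Vec Bool n) → length (webDiagram v) ≡ suc n
length-web {n} v = trans (cong length (webEdges-path 1 1 v))
  (trans (length-map _ (range 0 (suc n))) (length-range 0 (suc n)))

-- The k-th element of a list of numbers (0 past its end).
nth : List ℕ → ℕ → ℕ
nth [] k = 0
nth (x ∷ xs) zero = x
nth (x ∷ xs) (suc k) = nth xs k

nth-bound : ∀ {ℓ} (xs : List (Fin ℓ)) k → k < length xs → nth (map toℕ xs) k < ℓ
nth-bound (x ∷ xs) zero _ = toℕ<n x
nth-bound (x ∷ xs) (suc k) (s≤s k<) = nth-bound xs k k<

zip-range : ∀ r (F : ℕ → Edge) (ys : List ℕ) → length ys ≡ r →
  zip (map F (range 0 r)) ys ≡ map (λ k → (F k , nth ys k)) (range 0 r)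
zip-range zero F ys _ = refl
zip-range (suc r) F (y ∷ ys) len = cong ((F 0 , y) ∷_)
  (trans (cong (λ L → zip (map F L) ys) (range-suc 0 r))
   (trans (cong (λ L → zip L ys) (sym (map-∘ {g = F} {f = suc} (range 0 r))))
    (trans (zip-range r (F ∘ suc) ys (suc-injective len))
     (trans (map-∘ {g = λ k → (F k , nth (y ∷ ys) k)} {f = suc} (range 0 r)) (cong (map _) (sym (range-suc 0 r)))))))

compatible-all : ∀ {n} (v : Vec Bool n) ys → length ys ≡ suc n →
  compatible v ys ≡ all (λ j → ordered (choice v j) (nth ys j) (nth ys (suc j))) (range 0 n)
compatible-all [] ys _ = refl
compatible-all {suc n} (b ∷ v) (x ∷ y ∷ ys) len = cong (ordered b x y ∧_)
  (trans (compatible-all v (y ∷ ys) (suc-injective len))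
   (sym (trans (cong (all _) (range-suc 0 n)) (all-map _ suc (range 0 n)))))

all-by-peg : ∀ a r (L R : ℕ → Bool) →
  all (λ k → L k ∧ R k) (range a (suc r)) ≡ L a ∧ (all (λ j → R j ∧ L (suc j)) (range a r) ∧ R (a + r))
all-by-peg a zero L R rewrite +-identityʳ a = regroup (L a) (R a)
  where
  regroup : ∀ x y → ((x ∧ y) ∧ true) ≡ (x ∧ (true ∧ y))
  regroup true y = ∧-identityʳ y
  regroup false y = refl
all-by-peg a (suc r) L R rewrite +-suc a r | all-by-peg (suc a) r L R =
  regroup (L a) (R a) (L (suc a)) (all (λ j → R j ∧ L (suc j)) (range (suc a) r)) (R (suc (a + r)))
  where
  regroup : ∀ x y z w u → ((x ∧ y) ∧ (z ∧ (w ∧ u))) ≡ (x ∧ (((y ∧ z) ∧ w) ∧ u))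
  regroup true true z w u = sym (∧-assoc z w u)
  regroup true false z w u = refl
  regroup false y z w u = refl

-- An endpoint at height 1 stays there iff the other endpoint on its peg is
-- not placed below it, and one at height 2 iff the other one is.
stays-at-1 : ∀ x y → (suc (ind (y <ᵇ x)) ≡ᵇ 1) ≡ (x ≤ᵇ y)
stays-at-1 zero zero = refl
stays-at-1 zero (suc y) = refl
stays-at-1 (suc x) zero = refl
stays-at-1 (suc x) (suc y) = trans (stays-at-1 x y) (sym (<ᵇ-suc x y))

stays-at-2 : ∀ x y → (suc (ind (y ≡ᵇ x) + ind (y <ᵇ x)) ≡ᵇ 2) ≡ (y ≤ᵇ x)
stays-at-2 zero zero = refl
stays-at-2 zero (suc y) = refl
stays-at-2 (suc x) zero = refl
stays-at-2 (suc x) (suc y) = trans (stays-at-2 x y) (sym (<ᵇ-suc y x))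

-- At an inner peg with choice b, both endpoints stay in place iff the
-- colours c₀, c₁ of the two edges are ordered as b prescribes.
inner-peg : ∀ b c₀ c₁ →
  ((suc (under c₀ c₁ (other b) (bit b)) ≡ᵇ other b) ∧ (suc (under c₁ c₀ (bit b) (other b)) ≡ᵇ bit b)) ≡ ordered b c₀ c₁
inner-peg true c₀ c₁
  rewrite *-zeroʳ (ind (c₁ ≡ᵇ c₀)) | *-identityʳ (ind (c₀ ≡ᵇ c₁)) | stays-at-1 c₀ c₁ | stays-at-2 c₁ c₀ = ∧-idem (c₀ ≤ᵇ c₁)
inner-peg false c₀ c₁
  rewrite *-identityʳ (ind (c₁ ≡ᵇ c₀)) | *-zeroʳ (ind (c₀ ≡ᵇ c₁)) | stays-at-2 c₀ c₁ | stays-at-1 c₁ c₀ = ∧-idem (c₁ ≤ᵇ c₀)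

web-stays : ∀ {n} (v : Vec Bool n) (cf : ℕ → ℕ) →
  Path.stays 1 (suc n) (leftHeight 1 v) (rightHeight v) cf ≡ all (λ j → ordered (choice v j) (cf j) (cf (suc j))) (range 0 n)
web-stays {n} v cf = begin
    stays
  ≡⟨ all-by-peg 0 n L R ⟩
    L 0 ∧ (all (λ j → R j ∧ L (suc j)) (range 0 n) ∧ R n)
  ≡⟨ cong₂ (λ u w → u ∧ (all (λ j → R j ∧ L (suc j)) (range 0 n) ∧ w))
           (cong (_≡ᵇ 1) (newLeft-first (s≤s z≤n))) (cong₂ _≡ᵇ_ (newRight-last n refl) (rightHeight-last v)) ⟩
    all (λ j → R j ∧ L (suc j)) (range 0 n) ∧ true
  ≡⟨ ∧-identityʳ _ ⟩
    all (λ j → R j ∧ L (suc j)) (range 0 n)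
  ≡⟨ all-cong-range 0 n _ _ (λ j _ j<n → trans (cong₂ _∧_ (cong (_≡ᵇ Y j) (newRight-inner j (s≤s j<n)))
                                                          (cong (_≡ᵇ X (suc j)) (newLeft-inner j (s≤s j<n))))
                                                (innerPeg j j<n)) ⟩
    all (λ j → ordered (choice v j) (cf j) (cf (suc j))) (range 0 n)
  ∎
  where
  X Y : ℕ → ℕ
  X = leftHeight 1 v
  Y = rightHeight v
  open Path 1 (suc n) X Y cf
  L R : ℕ → Bool
  L k = newLeft k ≡ᵇ X k
  R k = newRight k ≡ᵇ Y k
  innerPeg : ∀ j → j < n →
    ((suc (under (cf j) (cf (suc j)) (Y j) (X (suc j))) ≡ᵇ Y j) ∧ (suc (under (cf (suc j)) (cf j) (X (suc j)) (Y j)) ≡ᵇ X (suc j)))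
      ≡ ordered (choice v j) (cf j) (cf (suc j))
  innerPeg j j<n = trans
    (cong₂ (λ y x → (suc (under (cf j) (cf (suc j)) y x) ≡ᵇ y) ∧ (suc (under (cf (suc j)) (cf j) x y) ≡ᵇ x))
           (rightHeight-inner v j j<n) (leftHeight-inner 1 v j j<n))
    (inner-peg (choice v j) (cf j) (cf (suc j)))

reconstruct-web : ∀ {ℓ n} (v : Vec Bool n) (c : Vec (Fin ℓ) (length (webDiagram v))) →
  sameDiagramᵇ (reconstruct (webDiagram v) c) (webDiagram v) ≡ compatible v (colours c)
reconstruct-web {ℓ} {n} v c = begin
    sameDiagramᵇ (reconstruct D c) D
  ≡⟨ cong (sameDiagramᵇ (reconstruct D c)) D≡path ⟩
    sameDiagramᵇ (reconstruct D c) (map E (range 0 m))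
  ≡⟨ same-as-path (reconstruct D c) all-reconstruct ⟩
    stays
  ≡⟨ web-stays v cf ⟩
    all (λ j → ordered (choice v j) (cf j) (cf (suc j))) (range 0 n)
  ≡⟨ sym (compatible-all v cs length-cs) ⟩
    compatible v cs
  ∎
  where
  D : Diagram
  D = webDiagram v
  m : ℕ
  m = suc n
  cs : List ℕ
  cs = colours c
  cf : ℕ → ℕ
  cf = nth cs
  open Path 1 m (leftHeight 1 v) (rightHeight v) cf
  D≡path : D ≡ map E (range 0 m)
  D≡path = webEdges-path 1 1 v
  length-cs : length cs ≡ m
  length-cs = trans (length-map toℕ (toList c)) (trans (length-toList c) (length-web v))
  bound : ∀ k → k < m → cf k < ℓ
  bound k k<m = nth-bound (toList c) k (subst (k <_) (sym (trans (length-toList c) (length-web v))) k<m)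
  all-reconstruct : ∀ Q → all Q (reconstruct D c) ≡ all (Q ∘ moved) (range 0 m)
  all-reconstruct Q = begin
      all Q (reconstruct D c)
    ≡⟨ cong (all Q) (reconstruct-layers D c) ⟩
      all Q (foldl _⊕_ [] (map (rel ∘ Layers.layer (zip D cs)) (range 0 ℓ)))
    ≡⟨ cong (λ Z → all Q (foldl _⊕_ [] (map (rel ∘ Layers.layer Z) (range 0 ℓ))))
            (trans (cong (λ L → zip L cs) D≡path) (zip-range m E cs length-cs)) ⟩
      all Q (foldl _⊕_ [] (map (rel ∘ layer) (range 0 ℓ)))
    ≡⟨ all-layers Q ℓ ⟩
      all (λ s → all (Q ∘ placed s) (layer s)) (range 0 ℓ)
    ≡⟨ all-layers-by-edge ℓ Q bound ⟩
      all (Q ∘ moved) (range 0 m)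
    ∎

f-web : ∀ ℓ {n} (v : Vec Bool n) →
  f (webDiagram v) (webDiagram v) ℓ ≡ length (boolFilter (λ c → surjectiveᵇ c ∧ compatible v (colours c)) (allVecs ℓ (suc n)))
f-web ℓ v = trans (cong length (filter-cong (allVecs ℓ (length (webDiagram v))) (λ c → cong (surjectiveᵇ c ∧_) (reconstruct-web v c))))
                  (resize (length (webDiagram v)) (length-web v))
  where
  resize : ∀ {n} N → N ≡ suc n →
    length (boolFilter (λ (c : Vec (Fin ℓ) N) → surjectiveᵇ c ∧ compatible v (colours c)) (allVecs ℓ N))
      ≡ length (boolFilter (λ (c : Vec (Fin ℓ) (suc n)) → surjectiveᵇ c ∧ compatible v (colours c)) (allVecs ℓ (suc n)))
  resize N refl = refl

trace-zero : ∀ n → traceCoeff n 0 ≡ 0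
trace-zero n = trans (∑-map (allBoolVecs n) webDiagram _) (∑-zero (allBoolVecs n) (λ _ → refl))

trace-suc : ∀ n k → traceCoeff n (suc k) ≡ suc k ! * rStirling n 2 k
trace-suc n k = begin
    traceCoeff n (suc k)
  ≡⟨ ∑-map (allBoolVecs n) webDiagram (λ D → webColouringCoeff D D (suc k)) ⟩
    ∑ (allBoolVecs n) (λ v → f (webDiagram v) (webDiagram v) (suc k))
  ≡⟨ ∑-cong (allBoolVecs n) (f-web (suc k)) ⟩
    Counting.compatibleSurjections (suc k) n
  ≡⟨ Counting.compatibleSurjections≡ (suc k) n ⟩
    suc k * (k ! * rStirling n 2 k)
  ≡⟨ sym (*-assoc (suc k) (k !) (rStirling n 2 k)) ⟩
    suc k ! * rStirling n 2 k
  ∎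

open import Data.Integer using (+_) renaming (_*_ to _*ℤ_; _-_ to _-ℤ_)
import Data.Integer.Properties as ℤ

pos-+-cancel : ∀ a b → + (a + b) -ℤ + b ≡ + a
pos-+-cancel a b = trans (ℤ.m-n≡m⊖n (a + b) b) (trans (ℤ.⊖-≥ (m≤n+m b a)) (cong +_ (m+n∸n≡m a b)))

theorem7p5 : (n : ℕ) → 1 ≤ n → (k : ℕ) → + traceCoeff n k ≡ rhsCoeff n k
theorem7p5 n _ zero = cong +_ (trace-zero n)
theorem7p5 n _ (suc k) with k ≤? n
... | yes k≤n rewrite ≤ᵇ-true (suc k) (suc n) (s≤s k≤n) = begin
    + traceCoeff n (suc k)
  ≡⟨ cong +_ (trace-suc n k) ⟩
    + (suc k ! * rStirling n 2 k)
  ≡⟨ ℤ.pos-* (suc k !) (rStirling n 2 k) ⟩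
    + (suc k !) *ℤ + rStirling n 2 k
  ≡⟨ cong (+ (suc k !) *ℤ_) (sym (pos-+-cancel (rStirling n 2 k) (S (suc n) (suc (suc k))))) ⟩
    + (suc k !) *ℤ (+ (rStirling n 2 k + S (suc n) (suc (suc k))) -ℤ + S (suc n) (suc (suc k)))
  ≡⟨ cong (λ s → + (suc k !) *ℤ (+ s -ℤ + S (suc n) (suc (suc k)))) (sym (stirling-split n k)) ⟩
    + (suc k !) *ℤ (+ S (suc (suc n)) (suc (suc k)) -ℤ + S (suc n) (suc (suc k)))
  ∎
... | no k≰n rewrite ≤ᵇ-false (suc k) (suc n) (s≤s (≰⇒> k≰n)) =
  cong +_ (trans (trace-suc n k) (trans (cong (suc k ! *_) (rStirling-vanish n 2 k (≰⇒> k≰n))) (*-zeroʳ (suc k !))))
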